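{- Let $p\geq 2$ be an integer. Suppose $D$ is a $p$-decomposition of a graph $G$ with width $k$, and $J$ is a decomposition of the graph $D$ with width $\ell$. Then $G$ has a $p$-decomposition isomorphic (as a graph) to $J$ with width $k\ell$. If moreover $D$ is a strong $p$-decomposition of $G$, then $G$ has a strong $p$-decomposition isomorphic to $J$ with width $k\ell$.
   Context: All graphs are finite, simple and undirected. A decomposition of a graph $G$ is a graph $D$ whose vertices (called bags) are subsets of $V(G)$ (distinct vertices of $D$ may be equal as sets), such that for each vertex $v$ of $G$ the subgraph $D(v)$ of $D$ induced by the bags containing $v$ is nonempty and connected, and for each edge $vw$ of $G$ the subgraphs $D(v)$ and $D(w)$ touch (they share a bag, or some bag containing $v$ is adjacent in $D$ to some bag containing $w$). The width is the maximum cardinality of a bag. $D$ is a $p$-decomposition if every clique of $G$ with at most $p$ vertices is a subset of some bag or of the union of two adjacent bags of $D$; it is a strong $p$-decomposition if every such clique is a subset of some bag. A decomposition $J$ of $D$ is defined in the same way with $D$ in place of $G$ (its bags are sets of vertices of $D$). -}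

module Defs where

open import Data.Nat using (ℕ; _≤_; _*_)
open import Data.Fin using (Fin)
open import Data.Fin.Subset using (Subset; _∈_; _∉_; _⊆_; _∪_; ∣_∣)
open import Data.Product using (Σ; ∃; ∃-syntax; _×_; _,_)
open import Data.Sum using (_⊎_)
open import Data.Empty using (⊥)
open import Relation.Nullary using (¬_)
open import Relation.Binary.PropositionalEquality using (_≡_)
open import Function.Bundles using (_↔_; Inverse)

record Graph : Set₁ where
  field
    n      : ℕ
    E      : Fin n → Fin n → Set
    sym    : ∀ {x y} → E x y → E y x
    irrefl : ∀ {x} → ¬ E x x
open Graph public

data WalkIn (H : Graph) (P : Fin (n H) → Set) : Fin (n H) → Fin (n H) → Set where
  here : ∀ {a} → P a → WalkIn H P a a
  step : ∀ {a b c} → P a → E H a b → WalkIn H P b c → WalkIn H P a c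

NonemptyConnected : (H : Graph) → (Fin (n H) → Set) → Set
NonemptyConnected H P = (∃[ a ] P a) × (∀ a b → P a → P b → WalkIn H P a b)

Touch : (H : Graph) → (Fin (n H) → Set) → (Fin (n H) → Set) → Set
Touch H P Q = ∃[ a ] ∃[ b ] (P a × Q b × (a ≡ b ⊎ E H a b))

record Decomposition (G : Graph) : Set₁ where
  field
    graph     : Graph
    bag       : Fin (n graph) → Subset (n G)
    connected : ∀ (v : Fin (n G)) → NonemptyConnected graph (λ a → v ∈ bag a)
    touching  : ∀ (v w : Fin (n G)) → E G v w →
                Touch graph (λ a → v ∈ bag a) (λ a → w ∈ bag a)
open Decomposition public

WidthAtMost : ∀ {G} → Decomposition G → ℕ → Set
WidthAtMost D k = ∀ a → ∣ bag D a ∣ ≤ k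

IsClique : (G : Graph) → Subset (n G) → Set
IsClique G C = ∀ v w → v ∈ C → w ∈ C → ¬ (v ≡ w) → E G v w

IsPDecomposition : ∀ {G} → ℕ → Decomposition G → Set
IsPDecomposition {G} p D =
  ∀ (C : Subset (n G)) → IsClique G C → ∣ C ∣ ≤ p →
    (∃[ a ] C ⊆ bag D a) ⊎
    (∃[ a ] ∃[ b ] (E (graph D) a b × C ⊆ (bag D a ∪ bag D b)))

IsStrongPDecomposition : ∀ {G} → ℕ → Decomposition G → Set
IsStrongPDecomposition {G} p D =
  ∀ (C : Subset (n G)) → IsClique G C → ∣ C ∣ ≤ p → ∃[ a ] C ⊆ bag D a

Isomorphic : Graph → Graph → Set
Isomorphic H K =
  Σ (Fin (n H) ↔ Fin (n K)) λ f →
    ∀ x y → (E H x y → E K (Inverse.to f x) (Inverse.to f y))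
          × (E K (Inverse.to f x) (Inverse.to f y) → E H x y)

module Submission where

-- The bags of the new decomposition are indexed by the bags x of J, and bag x is the union of
-- the D-bags that J places in x.  For a vertex v of G the new bags containing v are the union,
-- over the D-bags a containing v, of the J-bags containing a; each J(a) is connected, and
-- consecutive ones along a walk in D(v) touch, so the union is connected.  A clique inside one
-- D-bag a lies in every new bag of J(a), and one inside two adjacent D-bags a, b lies in one new
-- bag or two adjacent ones because J(a) and J(b) touch.  A new bag is a union of at most ℓ sets
-- of size at most k.

open import Defs
open import Data.Nat using (ℕ; _≤_; _*_; _+_; suc; z≤n; s≤s)
open import Data.Nat.Properties using (≤-trans; ≤-reflexive; +-mono-≤; +-suc; *-suc; *-zeroʳ; m≤n⇒m≤1+n; *-monoʳ-≤)
open import Data.Product using (∃-syntax; _×_; _,_; proj₁; proj₂)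
open import Data.Sum using (_⊎_; inj₁; inj₂; map; reduce)
open import Data.Fin using (Fin; zero; suc)
open import Data.Fin.Subset using (Subset; _∪_; ∣_∣; _∈_; _⊆_; ⊥; inside; outside)
open import Data.Fin.Subset.Properties using (x∈p∪q⁻; x∈p∪q⁺; ∉⊥; ∣⊥∣≡0)
open import Data.Vec using (_∷_; []; here; there)
open import Data.Empty using (⊥-elim)
open import Function using (_∘_)
open import Relation.Binary.PropositionalEquality as ≡ using (_≡_; refl)
open import Function.Construct.Identity using (↔-id)

∣p∪q∣≤∣p∣+∣q∣ : ∀ {m} (p q : Subset m) → ∣ p ∪ q ∣ ≤ ∣ p ∣ + ∣ q ∣
∣p∪q∣≤∣p∣+∣q∣ [] [] = z≤n
∣p∪q∣≤∣p∣+∣q∣ (inside ∷ p) (inside ∷ q) =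
  s≤s (≤-trans (m≤n⇒m≤1+n (∣p∪q∣≤∣p∣+∣q∣ p q)) (≤-reflexive (≡.sym (+-suc ∣ p ∣ ∣ q ∣))))
∣p∪q∣≤∣p∣+∣q∣ (inside ∷ p) (outside ∷ q) = s≤s (∣p∪q∣≤∣p∣+∣q∣ p q)
∣p∪q∣≤∣p∣+∣q∣ (outside ∷ p) (inside ∷ q) =
  ≤-trans (s≤s (∣p∪q∣≤∣p∣+∣q∣ p q)) (≤-reflexive (≡.sym (+-suc ∣ p ∣ ∣ q ∣)))
∣p∪q∣≤∣p∣+∣q∣ (outside ∷ p) (outside ∷ q) = ∣p∪q∣≤∣p∣+∣q∣ p q

⋃[_∈_] : ∀ {m N} → (Fin m → Subset N) → Subset m → Subset N
⋃[ f ∈ [] ] = ⊥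
⋃[ f ∈ inside ∷ s ] = f zero ∪ ⋃[ f ∘ suc ∈ s ]
⋃[ f ∈ outside ∷ s ] = ⋃[ f ∘ suc ∈ s ]

x∈⋃⁺ : ∀ {m N} (f : Fin m → Subset N) (s : Subset m) {a v} → a ∈ s → v ∈ f a → v ∈ ⋃[ f ∈ s ]
x∈⋃⁺ f (inside ∷ s) here v∈fa = x∈p∪q⁺ (inj₁ v∈fa)
x∈⋃⁺ f (inside ∷ s) (there a∈s) v∈fa = x∈p∪q⁺ (inj₂ (x∈⋃⁺ (f ∘ suc) s a∈s v∈fa))
x∈⋃⁺ f (outside ∷ s) (there a∈s) v∈fa = x∈⋃⁺ (f ∘ suc) s a∈s v∈fa

x∈⋃⁻ : ∀ {m N} (f : Fin m → Subset N) (s : Subset m) {v} → v ∈ ⋃[ f ∈ s ] → ∃[ a ] (a ∈ s × v ∈ f a)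
x∈⋃⁻ f [] v∈⋃ = ⊥-elim (∉⊥ v∈⋃)
x∈⋃⁻ f (inside ∷ s) v∈⋃ with x∈p∪q⁻ (f zero) ⋃[ f ∘ suc ∈ s ] v∈⋃
... | inj₁ v∈f0 = zero , here , v∈f0
... | inj₂ v∈⋃′ with x∈⋃⁻ (f ∘ suc) s v∈⋃′
...   | a , a∈s , v∈fa = suc a , there a∈s , v∈fa
x∈⋃⁻ f (outside ∷ s) v∈⋃ with x∈⋃⁻ (f ∘ suc) s v∈⋃
... | a , a∈s , v∈fa = suc a , there a∈s , v∈fa

∣⋃∣≤k*∣s∣ : ∀ {m N} (f : Fin m → Subset N) {k} → (∀ a → ∣ f a ∣ ≤ k) → (s : Subset m) →
            ∣ ⋃[ f ∈ s ] ∣ ≤ k * ∣ s ∣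
∣⋃∣≤k*∣s∣ {N = N} f {k} _ [] = ≤-reflexive (≡.trans (∣⊥∣≡0 N) (≡.sym (*-zeroʳ k)))
∣⋃∣≤k*∣s∣ f {k} ∣f∣≤k (inside ∷ s) = begin
  ∣ f zero ∪ ⋃[ f ∘ suc ∈ s ] ∣     ≤⟨ ∣p∪q∣≤∣p∣+∣q∣ (f zero) ⋃[ f ∘ suc ∈ s ] ⟩
  ∣ f zero ∣ + ∣ ⋃[ f ∘ suc ∈ s ] ∣ ≤⟨ +-mono-≤ (∣f∣≤k zero) (∣⋃∣≤k*∣s∣ (f ∘ suc) (∣f∣≤k ∘ suc) s) ⟩
  k + k * ∣ s ∣                     ≡⟨ ≡.sym (*-suc k ∣ s ∣) ⟩
  k * suc ∣ s ∣                     ∎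
  where open Data.Nat.Properties.≤-Reasoning
∣⋃∣≤k*∣s∣ f ∣f∣≤k (outside ∷ s) = ∣⋃∣≤k*∣s∣ (f ∘ suc) (∣f∣≤k ∘ suc) s

mapWalk : ∀ {H P Q} → (∀ {a} → P a → Q a) → ∀ {a b} → WalkIn H P a b → WalkIn H Q a b
mapWalk f (here pa) = here (f pa)
mapWalk f (step pa e w) = step (f pa) e (mapWalk f w)

_++ʷ_ : ∀ {H P a b c} → WalkIn H P a b → WalkIn H P b c → WalkIn H P a c
here _ ++ʷ w′ = w′
step pa e w ++ʷ w′ = step pa e (w ++ʷ w′)

module Composition {G : Graph} (D : Decomposition G) (J : Decomposition (graph D)) where

  composedBag : Fin (n (graph J)) → Subset (n G)
  composedBag x = ⋃[ bag D ∈ bag J x ]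

  ∈-composedBag : ∀ {x a v} → a ∈ bag J x → v ∈ bag D a → v ∈ composedBag x
  ∈-composedBag {x} = x∈⋃⁺ (bag D) (bag J x)

  ⊆-composedBag : ∀ {C a} → C ⊆ bag D a → ∃[ x ] C ⊆ composedBag x
  ⊆-composedBag {a = a} C⊆a with proj₁ (connected J a)
  ... | x , a∈x = x , ∈-composedBag a∈x ∘ C⊆a

  walkInside : ∀ {v a x y} → v ∈ bag D a → a ∈ bag J x → a ∈ bag J y →
               WalkIn (graph J) (λ z → v ∈ composedBag z) x y
  walkInside {a = a} v∈a a∈x a∈y =
    mapWalk (λ a∈z → ∈-composedBag a∈z v∈a) (proj₂ (connected J a) _ _ a∈x a∈y)

  liftWalk : ∀ {v a b x y} → WalkIn (graph D) (λ c → v ∈ bag D c) a b → a ∈ bag J x → b ∈ bag J y →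
             WalkIn (graph J) (λ z → v ∈ composedBag z) x y
  liftWalk (here v∈a) a∈x a∈y = walkInside v∈a a∈x a∈y
  liftWalk (step v∈a e w) a∈x b∈y with touching J _ _ e
  ... | z , z′ , a∈z , b∈z′ , inj₁ refl = walkInside v∈a a∈x a∈z ++ʷ liftWalk w b∈z′ b∈y
  ... | z , z′ , a∈z , b∈z′ , inj₂ zz′ =
        walkInside v∈a a∈x a∈z ++ʷ step (∈-composedBag a∈z v∈a) zz′ (liftWalk w b∈z′ b∈y)

  composedConnected : ∀ v → NonemptyConnected (graph J) (λ x → v ∈ composedBag x)
  composedConnected v = nonempty , walk
    where
    nonempty : ∃[ x ] v ∈ composedBag x
    nonempty with proj₁ (connected D v)
    ... | a , v∈a with proj₁ (connected J a)
    ...   | x , a∈x = x , ∈-composedBag a∈x v∈a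
    walk : ∀ x y → v ∈ composedBag x → v ∈ composedBag y → WalkIn (graph J) (λ z → v ∈ composedBag z) x y
    walk x y v∈x v∈y with x∈⋃⁻ (bag D) (bag J x) v∈x | x∈⋃⁻ (bag D) (bag J y) v∈y
    ... | a , a∈x , v∈a | b , b∈y , v∈b = liftWalk (proj₂ (connected D v) a b v∈a v∈b) a∈x b∈y

  composedTouching : ∀ v w → E G v w → Touch (graph J) (λ x → v ∈ composedBag x) (λ x → w ∈ composedBag x)
  composedTouching v w vw with touching D v w vw
  ... | a , b , v∈a , w∈b , inj₁ refl with proj₁ (connected J a)
  ...   | x , a∈x = x , x , ∈-composedBag a∈x v∈a , ∈-composedBag a∈x w∈b , inj₁ refl
  composedTouching v w vw | a , b , v∈a , w∈b , inj₂ ab with touching J a b ab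
  ...   | x , y , a∈x , b∈y , x≡y⊎xy = x , y , ∈-composedBag a∈x v∈a , ∈-composedBag b∈y w∈b , x≡y⊎xy

  compose : Decomposition G
  compose = record
    { graph     = graph J
    ; bag       = composedBag
    ; connected = composedConnected
    ; touching  = composedTouching
    }

  compose-width : ∀ {k ℓ} → WidthAtMost D k → WidthAtMost J ℓ → WidthAtMost compose (k * ℓ)
  compose-width {k} ∣D∣≤k ∣J∣≤ℓ x = ≤-trans (∣⋃∣≤k*∣s∣ (bag D) ∣D∣≤k (bag J x)) (*-monoʳ-≤ k (∣J∣≤ℓ x))

  compose-isPDecomposition : ∀ {p} → IsPDecomposition p D → IsPDecomposition p compose
  compose-isPDecomposition pD C clique ∣C∣≤p with pD C clique ∣C∣≤p
  ... | inj₁ (a , C⊆a) = inj₁ (⊆-composedBag C⊆a)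
  ... | inj₂ (a , b , ab , C⊆a∪b) with touching J a b ab
  ...   | x , y , a∈x , b∈y , x≡y⊎xy = lift x≡y⊎xy
    where
    inComposed : ∀ {v} → v ∈ bag D a ⊎ v ∈ bag D b → v ∈ composedBag x ⊎ v ∈ composedBag y
    inComposed = map (∈-composedBag a∈x) (∈-composedBag b∈y)
    lift : x ≡ y ⊎ E (graph J) x y →
           (∃[ z ] C ⊆ composedBag z) ⊎
           (∃[ z ] ∃[ z′ ] (E (graph J) z z′ × C ⊆ (composedBag z ∪ composedBag z′)))
    lift (inj₁ refl) = inj₁ (x , reduce ∘ inComposed ∘ x∈p∪q⁻ _ _ ∘ C⊆a∪b)
    lift (inj₂ xy) = inj₂ (x , y , xy , x∈p∪q⁺ ∘ inComposed ∘ x∈p∪q⁻ _ _ ∘ C⊆a∪b)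

  compose-isStrongPDecomposition : ∀ {p} → IsStrongPDecomposition p D → IsStrongPDecomposition p compose
  compose-isStrongPDecomposition pD C clique ∣C∣≤p = ⊆-composedBag (proj₂ (pD C clique ∣C∣≤p))

  compose≅J : Isomorphic (graph compose) (graph J)
  compose≅J = ↔-id _ , λ x y → (λ xy → xy) , (λ xy → xy)

open Composition using (compose; compose-width; compose-isPDecomposition; compose-isStrongPDecomposition; compose≅J)

lemma3p4 : (p : ℕ) → 2 ≤ p → (G : Graph) → (D : Decomposition G) → (k ℓ : ℕ) →
    IsPDecomposition p D → WidthAtMost D k →
    (J : Decomposition (graph D)) → WidthAtMost J ℓ →
    (∃[ D′ ] (IsPDecomposition p D′ × Isomorphic (graph D′) (graph J) × WidthAtMost {G} D′ (k * ℓ)))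
    × (IsStrongPDecomposition p D →
       ∃[ D′ ] (IsStrongPDecomposition p D′ × Isomorphic (graph D′) (graph J) × WidthAtMost {G} D′ (k * ℓ)))
lemma3p4 p _ G D k ℓ pD ∣D∣≤k J ∣J∣≤ℓ =
  (compose D J , compose-isPDecomposition D J pD , compose≅J D J , width) ,
  (λ strong → compose D J , compose-isStrongPDecomposition D J strong , compose≅J D J , width)
  where
  width : WidthAtMost (compose D J) (k * ℓ)
  width = compose-width D J ∣D∣≤k ∣J∣≤ℓ
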